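{- Let $G$ be a finite connected graph, let $H$ be a retract of $G$, and let $k$ be a non-negative integer. If $G \in \mathcal{CWRC}(k)$, then $H \in \mathcal{CWRC}(k)$.
   Context: All graphs are finite and simple. Cop and robber game with radius of capture $k$ on a graph $G$: first the cop chooses a vertex, then the robber chooses a vertex; afterwards, starting with the cop, the players alternately either move to an adjacent vertex or stay at their current vertex, both always knowing both positions. The cop wins if at some point of the game the distance $d_G$ between the cop's and the robber's vertices is at most $k$; the robber wins if this never happens. $\mathcal{CWRC}(k)$ denotes the class of graphs on which the cop has a winning strategy in this game regardless of the robber's play. An induced subgraph $H$ of $G$ is a retract of $G$ if there is a map $f:V(G)\to V(H)$ that maps edges to edges (if $xy\in E(G)$ then $f(x)f(y)\in E(H)$) and satisfies $f(h)=h$ for all $h\in V(H)$. -}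

module Defs where

open import Data.Nat using (ℕ; zero; suc; _≤_)
open import Data.Fin using (Fin)
open import Data.Product using (Σ; ∃; _×_; _,_; proj₁; proj₂)
open import Data.Sum using (_⊎_)
open import Data.List using (List; []; _∷_)
open import Relation.Nullary using (¬_; Dec)
open import Relation.Binary.PropositionalEquality using (_≡_)
open import Function.Definitions using (Injective)

record Graph : Set₁ where
  field
    n      : ℕ
    Adj    : Fin n → Fin n → Set
    Adj?   : ∀ u v → Dec (Adj u v)
    sym    : ∀ {u v} → Adj u v → Adj v u
    irrefl : ∀ {u} → ¬ Adj u u

open Graph public

V : Graph → Set
V G = Fin (n G)

data Walk (G : Graph) : V G → V G → ℕ → Set where
  here : ∀ {u} → Walk G u u 0
  step : ∀ {u v w l} → Adj G u v → Walk G v w l → Walk G u w (suc l)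

-- d_G(u,v) ≤ k  (distance is the length of a shortest walk)
DistLe : (G : Graph) → ℕ → V G → V G → Set
DistLe G k u v = ∃ λ l → l ≤ k × Walk G u v l

Connected : Graph → Set
Connected G = ∀ u v → ∃ λ l → Walk G u v l

Move : (G : Graph) → V G → V G → Set
Move G u v = u ≡ v ⊎ Adj G u v

-- A (history-dependent) cop strategy: an initial vertex, and a rule giving the
-- next cop vertex from the current cop vertex, the current robber vertex and
-- the list of earlier (cop , robber) position pairs (most recent first).
record CopStrategy (G : Graph) : Set where
  field
    start : V G
    move  : V G → V G → List (V G × V G) → V G
    legal : ∀ c r h → Move G c (move c r h)

-- A robber play: the sequence of robber vertices r₀ r₁ r₂ …, each a legal move.
-- (Against a fixed deterministic cop strategy, quantifying over all such
-- sequences is the same as quantifying over all robber strategies.)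
record RobberPlay (G : Graph) : Set where
  field
    pos   : ℕ → V G
    legal : ∀ i → Move G (pos i) (pos (suc i))

copState : {G : Graph} → CopStrategy G → RobberPlay G → ℕ → V G × List (V G × V G)
copState σ ρ zero = CopStrategy.start σ , []
copState σ ρ (suc i) with copState σ ρ i
... | c , h = CopStrategy.move σ c (RobberPlay.pos ρ i) h , (c , RobberPlay.pos ρ i) ∷ h

copPos : {G : Graph} → CopStrategy G → RobberPlay G → ℕ → V G
copPos σ ρ i = proj₁ (copState σ ρ i)

-- The play visits positions (c₀,r₀), (c₁,r₀), (c₁,r₁), (c₂,r₁), …
-- The cop wins if at some such position the distance is at most k.
Wins : (G : Graph) → ℕ → CopStrategy G → Set
Wins G k σ = (ρ : RobberPlay G) → ∃ λ i →
  DistLe G k (copPos σ ρ i) (RobberPlay.pos ρ i)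
  ⊎ DistLe G k (copPos σ ρ (suc i)) (RobberPlay.pos ρ i)

CWRC : ℕ → Graph → Set
CWRC k G = Σ (CopStrategy G) (Wins G k)

induced : (G : Graph) (m : ℕ) (ι : Fin m → V G) → Graph
induced G m ι = record
  { n = m
  ; Adj = λ a b → Adj G (ι a) (ι b)
  ; Adj? = λ a b → Adj? G (ι a) (ι b)
  ; sym = sym G
  ; irrefl = irrefl G
  }

IsRetraction : (G : Graph) (m : ℕ) (ι : Fin m → V G) → (V G → Fin m) → Set
IsRetraction G m ι f =
  Injective _≡_ _≡_ ι
  × (∀ {x y} → Adj G x y → Adj (induced G m ι) (f x) (f y))
  × (∀ h → f (ι h) ≡ h)

{-# OPTIONS --safe #-}
-- The cop on the retract H plays the image under f of a winning cop strategy on G,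
-- run against the robber's moves pushed into G by the inclusion ι. Since f maps
-- walks to walks of the same length and fixes H, every capture in G at distance at
-- most k is mapped to a capture in H at distance at most k.
module Submission where

open import Defs
open import Data.Nat using (ℕ; zero; suc)
open import Data.Fin using (Fin; _≟_)
open import Data.Product using (_×_; _,_; proj₁; proj₂; map₂)
open import Data.Sum using (inj₁; inj₂) renaming (map to map-⊎)
open import Data.List using (List; []; _∷_)
open import Relation.Nullary using (Dec; yes; no; contradiction)
open import Relation.Nullary.Decidable using (_⊎-dec_)
open import Relation.Binary.PropositionalEquality
  using (_≡_; refl; cong; cong₂; subst₂; module ≡-Reasoning)
import Relation.Binary.PropositionalEquality as ≡

Move? : (G : Graph) (u v : V G) → Dec (Move G u v)
Move? G u v = (u ≟ v) ⊎-dec Adj? G u v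

-- Strategies must prescribe a legal move at every position, including positions
-- that never occur in play; there the cop simply stays.
moveIfLegal : (G : Graph) → V G → V G → V G
moveIfLegal G u v with Move? G u v
... | yes _ = v
... | no _  = u

moveIfLegal-legal : (G : Graph) (u v : V G) → Move G u (moveIfLegal G u v)
moveIfLegal-legal G u v with Move? G u v
... | yes u→v = u→v
... | no _    = inj₁ refl

moveIfLegal-≡ : (G : Graph) {u v : V G} → Move G u v → moveIfLegal G u v ≡ v
moveIfLegal-≡ G {u} {v} u→v with Move? G u v
... | yes _  = refl
... | no ¬m  = contradiction u→v ¬m

copStep : {G : Graph} → CopStrategy G → V G → V G × List (V G × V G) → V G × List (V G × V G)
copStep σ r (c , h) = CopStrategy.move σ c r h , (c , r) ∷ h

record Homomorphism (G H : Graph) : Set where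
  field
    map     : V G → V H
    map-Adj : ∀ {x y} → Adj G x y → Adj H (map x) (map y)

  map-Move : ∀ {x y} → Move G x y → Move H (map x) (map y)
  map-Move (inj₁ refl) = inj₁ refl
  map-Move (inj₂ x~y)  = inj₂ (map-Adj x~y)

  map-Walk : ∀ {x y l} → Walk G x y l → Walk H (map x) (map y) l
  map-Walk here         = here
  map-Walk (step x~z w) = step (map-Adj x~z) (map-Walk w)

  map-DistLe : ∀ {k x y} → DistLe G k x y → DistLe H k (map x) (map y)
  map-DistLe (l , l≤k , w) = l , l≤k , map-Walk w

  map-RobberPlay : RobberPlay G → RobberPlay H
  map-RobberPlay ρ = record
    { pos   = λ i → map (RobberPlay.pos ρ i)
    ; legal = λ i → map-Move (RobberPlay.legal ρ i)
    }

open Homomorphism using (map; map-Move; map-DistLe; map-RobberPlay)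

inclusion : (G : Graph) (m : ℕ) (ι : Fin m → V G) → Homomorphism (induced G m ι) G
inclusion G m ι = record { map = ι ; map-Adj = λ x~y → x~y }

module Shadow {G H : Graph} (ι : Homomorphism H G) (f : Homomorphism G H)
  (σ : CopStrategy G) where

  replay : List (V H × V H) → V G × List (V G × V G)
  replay []            = CopStrategy.start σ , []
  replay ((_ , r) ∷ h) = copStep σ (map ι r) (replay h)

  shadow : CopStrategy H
  shadow = record
    { start = map f (CopStrategy.start σ)
    ; move  = λ c r h → moveIfLegal H c (target r h)
    ; legal = λ c r h → moveIfLegal-legal H c (target r h)
    }
    where
    target : V H → List (V H × V H) → V H
    target r h = map f (proj₁ (copStep σ (map ι r) (replay h)))

  module _ (ρ : RobberPlay H) where

    private
      ρ′ : RobberPlay G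
      ρ′ = map-RobberPlay ι ρ

    replay-history : ∀ i → replay (proj₂ (copState shadow ρ i)) ≡ copState σ ρ′ i
    replay-history zero    = refl
    replay-history (suc i) = cong (copStep σ (map ι (RobberPlay.pos ρ i))) (replay-history i)

    copPos-shadow : ∀ i → copPos shadow ρ i ≡ map f (copPos σ ρ′ i)
    copPos-shadow zero    = refl
    copPos-shadow (suc i) = begin
      moveIfLegal H (copPos shadow ρ i) (map f (proj₁ (copStep σ r (replay h))))
        ≡⟨ cong₂ (moveIfLegal H) (copPos-shadow i)
                 (cong (λ s → map f (proj₁ (copStep σ r s))) (replay-history i)) ⟩
      moveIfLegal H (map f c) (map f (CopStrategy.move σ c r h′))
        ≡⟨ moveIfLegal-≡ H (map-Move f (CopStrategy.legal σ c r h′)) ⟩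
      map f (CopStrategy.move σ c r h′)
        ∎
      where
      open ≡-Reasoning
      r  = map ι (RobberPlay.pos ρ i)
      h  = proj₂ (copState shadow ρ i)
      c  = copPos σ ρ′ i
      h′ = proj₂ (copState σ ρ′ i)

    module _ (retracts : ∀ v → map f (map ι v) ≡ v) where

      shadow-DistLe : ∀ {k} j {i} → DistLe G k (copPos σ ρ′ j) (RobberPlay.pos ρ′ i) →
                      DistLe H k (copPos shadow ρ j) (RobberPlay.pos ρ i)
      shadow-DistLe {k} j {i} d =
        subst₂ (DistLe H k) (≡.sym (copPos-shadow j)) (retracts (RobberPlay.pos ρ i)) (map-DistLe f d)

  shadow-Wins : ∀ {k} → (∀ v → map f (map ι v) ≡ v) → Wins G k σ → Wins H k shadow
  shadow-Wins retracts σ-wins ρ =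
    map₂ (λ {i} → map-⊎ (shadow-DistLe ρ retracts i) (shadow-DistLe ρ retracts (suc i)))
         (σ-wins (map-RobberPlay ι ρ))

CWRC-retract : ∀ {G H k} (ι : Homomorphism H G) (f : Homomorphism G H) →
               (∀ v → map f (map ι v) ≡ v) → CWRC k G → CWRC k H
CWRC-retract ι f retracts (σ , σ-wins) = shadow , shadow-Wins retracts σ-wins
  where open Shadow ι f σ

theorem2p2 : (G : Graph) → Connected G →
    (m : ℕ) (ι : Fin m → V G) (f : V G → Fin m) → IsRetraction G m ι f →
    (k : ℕ) → CWRC k G → CWRC k (induced G m ι)
theorem2p2 G _ m ι f (_ , f-Adj , retracts) k =
  CWRC-retract (inclusion G m ι) (record { map = f ; map-Adj = f-Adj }) retracts
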